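{- Let $E/\mathbb{Q}$ be an elliptic curve of conductor $N$ and let $d \neq \pm 1, \pm 3$ be a square-free integer coprime to $N$. Then $E^d(\mathbb{Q})$ contains no point of order $3$.
   Context: For a nonzero integer $d$, the quadratic twist $E^d/\mathbb{Q}$ of $E: y^2=x^3+ax+b$ is the elliptic curve $y^2 = x^3 + d^2 a x + d^3 b$. -}

module Defs where

open import Data.Nat as ℕ using (ℕ; suc)
open import Data.Nat.Divisibility as ℕD using ()
open import Data.Nat.Primality using (Prime)
open import Data.Integer as ℤ using (ℤ; +_)
open import Data.Rational as ℚ using (ℚ; 0ℚ; 1ℚ; _+_; _*_; _-_; -_; _÷_; _/_; ↥_; ↧ₙ_; _≟_; ≢-nonZero)
open import Data.Maybe using (Maybe; just; nothing)
open import Data.Product using (_×_; _,_; Σ; ∃)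
open import Relation.Binary.PropositionalEquality using (_≡_; _≢_)
open import Relation.Nullary using (¬_; yes; no)

ℤ→ℚ : ℤ → ℚ
ℤ→ℚ z = z / 1

κ : ℕ → ℚ
κ n = (+ n) / 1

-- Short Weierstrass elliptic curve y² = x³ + a x + b over ℚ (nonsingular)
record EllipticCurve : Set where
  constructor mkE
  field
    a : ℚ
    b : ℚ
    nonsingular : κ 4 * (a * a * a) + κ 27 * (b * b) ≢ 0ℚ
open EllipticCurve public

twistA twistB : EllipticCurve → ℤ → ℚ
twistA E d = ℤ→ℚ d * ℤ→ℚ d * a E
twistB E d = ℤ→ℚ d * ℤ→ℚ d * ℤ→ℚ d * b E

-- Projective points of y² = x³ + A x + B over ℚ, in raw form:
-- nothing = the point at infinity O, just (x , y) an affine point.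
RawPt : Set
RawPt = Maybe (ℚ × ℚ)

OnCurve : (A B : ℚ) → RawPt → Set
OnCurve A B nothing = Data.Unit.⊤ where import Data.Unit
OnCurve A B (just (x , y)) = y * y ≡ x * x * x + A * x + B

addPt : (A B : ℚ) → RawPt → RawPt → RawPt
addPt A B nothing Q = Q
addPt A B (just P) nothing = just P
addPt A B (just (x₁ , y₁)) (just (x₂ , y₂)) with x₂ - x₁ ≟ 0ℚ
... | no dx≢0 = third (_÷_ (y₂ - y₁) (x₂ - x₁) {{≢-nonZero dx≢0}})
  where
  third : ℚ → RawPt
  third λ' = let x₃ = λ' * λ' - x₁ - x₂ in just (x₃ , - (λ' * (x₃ - x₁) + y₁))
... | yes _ with y₁ + y₂ ≟ 0ℚ
...   | yes _ = nothing
...   | no s≢0 = third (_÷_ (κ 3 * x₁ * x₁ + A) (y₁ + y₂) {{≢-nonZero s≢0}})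
  -- tangent case: for points on the curve with x₁ = x₂ and y₁ + y₂ ≠ 0 we have
  -- y₁ = y₂, so y₁ + y₂ = 2y₁ and this is the usual tangent slope (3x₁² + A)/(2y₁)
  where
  third : ℚ → RawPt
  third λ' = let x₃ = λ' * λ' - x₁ - x₂ in just (x₃ , - (λ' * (x₃ - x₁) + y₁))

HasOrder3 : (A B : ℚ) → RawPt → Set
HasOrder3 A B P = (P ≢ nothing) × (addPt A B (addPt A B P P) P ≡ nothing)

TwistHasPointOfOrder3 : EllipticCurve → ℤ → Set
TwistHasPointOfOrder3 E d =
  Σ RawPt λ P → OnCurve (twistA E d) (twistB E d) P × HasOrder3 (twistA E d) (twistB E d) P

-- Square-free integer: no square of an integer > 1 divides it (so d ≠ 0)
SquareFree : ℤ → Set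
SquareFree d = ∀ (n : ℕ) → (n ℕ.* n) ℕD.∣ ℤ.∣ d ∣ → n ≡ 1

PIntegral : ℕ → ℚ → Set
PIntegral p q = ¬ (p ℕD.∣ ↧ₙ q)

PUnit : ℕ → ℚ → Set
PUnit p q = ¬ (p ℕD.∣ ↧ₙ q) × ¬ (p ℕD.∣ ℤ.∣ ↥ q ∣)

-- General Weierstrass equation y² + a₁xy + a₃y = x³ + a₂x² + a₄x + a₆
record Weierstrass : Set where
  constructor mkW
  field
    a₁ a₂ a₃ a₄ a₆ : ℚ

-- its discriminant (Silverman, III.1)
disc : Weierstrass → ℚ
disc (mkW a₁ a₂ a₃ a₄ a₆) =
  let b₂ = a₁ * a₁ + κ 4 * a₂
      b₄ = κ 2 * a₄ + a₁ * a₃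
      b₆ = a₃ * a₃ + κ 4 * a₆
      b₈ = a₁ * a₁ * a₆ + κ 4 * a₂ * a₆ - a₁ * a₃ * a₄ + a₂ * a₃ * a₃ - a₄ * a₄
  in - (b₂ * b₂ * b₈) - κ 8 * (b₄ * b₄ * b₄) - κ 27 * (b₆ * b₆) + κ 9 * (b₂ * b₄ * b₆)

-- W is obtained from the short model y² = x³ + A x + B by the admissible change of
-- variables x = u²x' + r, y = u³y' + u²s x' + t  (u ≠ 0), Silverman Table 3.1
IsoToShort : (A B : ℚ) → Weierstrass → Set
IsoToShort A B (mkW a₁' a₂' a₃' a₄' a₆') =
  Σ ℚ λ u → Σ ℚ λ r → Σ ℚ λ s → Σ ℚ λ t →
    (u ≢ 0ℚ)
    × (u * a₁' ≡ κ 2 * s)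
    × (u * u * a₂' ≡ - s * s + κ 3 * r)
    × (u * u * u * a₃' ≡ κ 2 * t)
    × (u * u * u * u * a₄' ≡ A + κ 3 * (r * r) - κ 2 * (s * t))
    × (u * u * u * u * u * u * a₆' ≡ B + r * A + r * r * r - t * t)

GoodReduction : EllipticCurve → ℕ → Set
GoodReduction E p =
  Σ Weierstrass λ W → IsoToShort (a E) (b E) W
    × PIntegral p (Weierstrass.a₁ W) × PIntegral p (Weierstrass.a₂ W)
    × PIntegral p (Weierstrass.a₃ W) × PIntegral p (Weierstrass.a₄ W)
    × PIntegral p (Weierstrass.a₆ W) × PUnit p (disc W)

-- d is coprime to the conductor N of E: the primes dividing N are exactly the
-- primes of bad reduction, so this says every prime factor of d is a prime of good reduction
CoprimeToConductor : ℤ → EllipticCurve → Set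
CoprimeToConductor d E = ∀ (p : ℕ) → Prime p → p ℕD.∣ ℤ.∣ d ∣ → GoodReduction E p

-- Let P = (X, Y) be a point of order 3 on E^d. Then x₀ = X/d is a root of the 3-division
-- polynomial of E and 4(x₀³ + a x₀ + b) = d w² with w ∈ ℚ: P is a 3-torsion point of E defined
-- over ℚ(√d). Since d is square-free and d ≠ ±1, ±3, some prime p ≠ 3 divides d exactly once,
-- and E has good reduction at p. Move the point to a model W that is integral at p with
-- p-adic unit discriminant, with abscissa x there, and take the b-invariants of W translated
-- to x. Then b₈ = 0, so x is a root of a quartic with p-unit leading coefficient 3 and is
-- p-integral; and b₆ = (2y + a₁x + a₃)² = d w′² is p-integral, hence divisible by p as p ∥ d.
-- Now b₄² = b₂b₆ − 4b₈ is divisible by p, and so is Δ = −b₂²b₈ − 8b₄³ − 27b₆² + 9b₂b₄b₆: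
-- the reduction mod p is singular after all.

module Submission where

open import Defs
open import Level using (0ℓ)
open import Algebra.Bundles.Raw using (RawRing)
open import Algebra.Solver.Ring.AlmostCommutativeRing using (fromCommutativeRing)
import Algebra.Solver.Ring.Simple as RingSolver
import Data.Integer as ℤ
import Data.Integer.Properties as ℤP
import Data.Integer.Divisibility.Signed as ℤD
open import Data.List using ([]; _∷_)
open import Data.List.Relation.Unary.All using (All; _∷_)
open import Data.Maybe using (just; nothing)
open import Data.Nat as ℕ using (ℕ; suc)
import Data.Nat.Properties as ℕP
open import Data.Nat.Divisibility as ℕD using (_∣_; divides; _∣?_)
import Data.Nat.Coprimality as Coprimality
open import Data.Nat.ListAction using (product)
open import Data.Nat.Primality using (Prime; euclidsLemma; ¬prime[1]; prime?; prime⇒irreducible; prime⇒nonZero)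
open import Data.Nat.Primality.Factorisation using (factorise; PrimeFactorisation)
open import Data.Product using (Σ; _×_; _,_; proj₁)
open import Data.Sum as Sum using (_⊎_; inj₁; inj₂)
import Data.Rational as ℚ
import Data.Rational.Properties as ℚP
import Data.Rational.Unnormalised as ℚᵘ
import Data.Rational.Unnormalised.Properties as ℚᵘP
open import Function.Nary.NonDependent using (congₙ)
open import Relation.Binary.PropositionalEquality
open import Relation.Nullary using (¬_; yes; no; contradiction)
open import Relation.Nullary.Decidable using (toWitness)

-- Defined over a raw ring so that ℚ and the ring solver's syntax share the definitions:
-- ⟦ Poly.b₈-at … ⟧ unfolds to the ℚ-valued b₈-at, and ⟦ Poly.Δ … ⟧ to disc. The bᵢ-at are the b-invariants after the
-- translation x ↦ x + x₀ (Silverman, Table 3.1 with r = x₀): b₈-at is the 3-division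
-- polynomial, and at a point (x₀, y₀) of the curve b₆-at = (2y₀ + a₁x₀ + a₃)².
module Invariants (R : RawRing 0ℓ 0ℓ) (n̂ : ℕ → RawRing.Carrier R) where
  open RawRing R

  b₂ b₄ b₆ b₈ : (a₁ a₂ a₃ a₄ a₆ : Carrier) → Carrier
  b₂ a₁ a₂ a₃ a₄ a₆ = a₁ * a₁ + n̂ 4 * a₂
  b₄ a₁ a₂ a₃ a₄ a₆ = n̂ 2 * a₄ + a₁ * a₃
  b₆ a₁ a₂ a₃ a₄ a₆ = a₃ * a₃ + n̂ 4 * a₆
  b₈ a₁ a₂ a₃ a₄ a₆ = a₁ * a₁ * a₆ + n̂ 4 * a₂ * a₆ + - (a₁ * a₃ * a₄) + a₂ * a₃ * a₃ + - (a₄ * a₄)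

  Δᵇ : (c₂ c₄ c₆ c₈ : Carrier) → Carrier
  Δᵇ c₂ c₄ c₆ c₈ =
    - (c₂ * c₂ * c₈) + - (n̂ 8 * (c₄ * c₄ * c₄)) + - (n̂ 27 * (c₆ * c₆)) + n̂ 9 * (c₂ * c₄ * c₆)

  Δ : (a₁ a₂ a₃ a₄ a₆ : Carrier) → Carrier
  Δ a₁ a₂ a₃ a₄ a₆ =
    Δᵇ (b₂ a₁ a₂ a₃ a₄ a₆) (b₄ a₁ a₂ a₃ a₄ a₆) (b₆ a₁ a₂ a₃ a₄ a₆) (b₈ a₁ a₂ a₃ a₄ a₆)

  b₂-at b₄-at b₆-at b₈-at : (a₁ a₂ a₃ a₄ a₆ x : Carrier) → Carrier
  b₂-at a₁ a₂ a₃ a₄ a₆ x = n̂ 12 * x + b₂ a₁ a₂ a₃ a₄ a₆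
  b₄-at a₁ a₂ a₃ a₄ a₆ x = n̂ 6 * (x * x) + b₂ a₁ a₂ a₃ a₄ a₆ * x + b₄ a₁ a₂ a₃ a₄ a₆
  b₆-at a₁ a₂ a₃ a₄ a₆ x =
    n̂ 4 * (x * x * x) + b₂ a₁ a₂ a₃ a₄ a₆ * (x * x) + n̂ 2 * b₄ a₁ a₂ a₃ a₄ a₆ * x + b₆ a₁ a₂ a₃ a₄ a₆
  b₈-at a₁ a₂ a₃ a₄ a₆ x =
    n̂ 3 * (x * x * x * x) + b₂ a₁ a₂ a₃ a₄ a₆ * (x * x * x) + n̂ 3 * b₄ a₁ a₂ a₃ a₄ a₆ * (x * x)
      + n̂ 3 * b₆ a₁ a₂ a₃ a₄ a₆ * x + b₈ a₁ a₂ a₃ a₄ a₆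

open ℤ using (ℤ; +_; -_; -[1+_])
open ℚ using (ℚ; 0ℚ; 1ℚ; _+_; _*_; _-_; 1/_; ↥_; ↧_; _≟_)
open RingSolver (fromCommutativeRing ℚP.+-*-commutativeRing) _≟_
  using (solve; _:=_; _:+_; _:*_; :-_; con; Polynomial)
open Invariants ℚ.+-*-rawRing κ

polynomialRing : ℕ → RawRing 0ℓ 0ℓ
polynomialRing n = record
  { Carrier = Polynomial n ; _≈_ = _≡_ ; _+_ = _:+_ ; _*_ = _:*_ ; -_ = :-_
  ; 0# = con 0ℚ ; 1# = con 1ℚ }

module Poly {n : ℕ} = Invariants (polynomialRing n) (λ m → con (κ m))

*-cancelˡ-≢0 : ∀ {c a b} → c ≢ 0ℚ → c * a ≡ c * b → a ≡ b
*-cancelˡ-≢0 {c} {a} {b} c≢0 ca≡cb = begin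
  a              ≡⟨ 1/c*[c*x]≡x a ⟨
  1/ c * (c * a) ≡⟨ cong (1/ c *_) ca≡cb ⟩
  1/ c * (c * b) ≡⟨ 1/c*[c*x]≡x b ⟩
  b              ∎
  where
  open ≡-Reasoning
  instance
    c-nonZero : ℚ.NonZero c
    c-nonZero = ℚ.≢-nonZero c≢0
  1/c*[c*x]≡x : ∀ x → 1/ c * (c * x) ≡ x
  1/c*[c*x]≡x x = trans (sym (ℚP.*-assoc (1/ c) c x))
    (trans (cong (_* x) (ℚP.*-inverseˡ c)) (ℚP.*-identityˡ x))

*-≡0-cancelˡ : ∀ {c a} → c ≢ 0ℚ → c * a ≡ 0ℚ → a ≡ 0ℚ
*-≡0-cancelˡ {c} c≢0 ca≡0 = *-cancelˡ-≢0 c≢0 (trans ca≡0 (sym (ℚP.*-zeroʳ c)))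

*-≢0 : ∀ {a b} → a ≢ 0ℚ → b ≢ 0ℚ → a * b ≢ 0ℚ
*-≢0 a≢0 b≢0 ab≡0 = b≢0 (*-≡0-cancelˡ a≢0 ab≡0)

quotient : ∀ {a} → a ≢ 0ℚ → ∀ y → Σ ℚ λ x → a * x ≡ y
quotient {a} a≢0 y = y * 1/ a , (begin
  a * (y * 1/ a) ≡⟨ solve 3 (λ a y a⁻¹ → a :* (y :* a⁻¹) := y :* (a :* a⁻¹)) refl a y (1/ a) ⟩
  y * (a * 1/ a) ≡⟨ cong (y *_) (ℚP.*-inverseʳ a) ⟩
  y * 1ℚ         ≡⟨ ℚP.*-identityʳ y ⟩
  y              ∎)
  where
  open ≡-Reasoning
  instance
    a-nonZero : ℚ.NonZero a
    a-nonZero = ℚ.≢-nonZero a≢0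

÷-*-cancel : ∀ {q} a → (q≢0 : q ≢ 0ℚ) → ℚ._÷_ a q {{ℚ.≢-nonZero q≢0}} * q ≡ a
÷-*-cancel {q} a q≢0 =
  trans (ℚP.*-assoc a (1/ q) q) (trans (cong (a *_) (ℚP.*-inverseˡ q)) (ℚP.*-identityʳ a))
  where
  instance
    q-nonZero : ℚ.NonZero q
    q-nonZero = ℚ.≢-nonZero q≢0

square-quotient : ∀ {c F D Z} → c ≢ 0ℚ → c * c * F ≡ D * (Z * Z) → Σ ℚ λ w → F ≡ D * (w * w)
square-quotient {c} {F} {D} {Z} c≢0 c²F≡DZ² =
  let w , cw≡Z = quotient c≢0 Z in
  w , *-cancelˡ-≢0 (*-≢0 c≢0 c≢0) (begin
    c * c * F               ≡⟨ c²F≡DZ² ⟩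
    D * (Z * Z)             ≡⟨ cong (λ z → D * (z * z)) cw≡Z ⟨
    D * (c * w * (c * w))   ≡⟨ solve 3 (λ c D w → D :* (c :* w :* (c :* w)) := c :* c :* (D :* (w :* w)))
                                       refl c D w ⟩
    c * c * (D * (w * w))   ∎)
  where open ≡-Reasoning

toℚᵘ-ℤ→ℚ : ∀ z → ℚ.toℚᵘ (ℤ→ℚ z) ℚᵘ.≃ ℚᵘ.mkℚᵘ z 0
toℚᵘ-ℤ→ℚ z = ℚP.toℚᵘ-fromℚᵘ (ℚᵘ.mkℚᵘ z 0)

ℤ→ℚ-injective : ∀ {m n} → ℤ→ℚ m ≡ ℤ→ℚ n → m ≡ n
ℤ→ℚ-injective {m} {n} eq
  with ℚᵘP.≃-trans (ℚᵘP.≃-sym (toℚᵘ-ℤ→ℚ m)) (ℚᵘP.≃-trans (ℚP.toℚᵘ-cong eq) (toℚᵘ-ℤ→ℚ n))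
... | ℚᵘ.*≡* m*1≡n*1 = trans (sym (ℤP.*-identityʳ m)) (trans m*1≡n*1 (ℤP.*-identityʳ n))

ℤ→ℚ-homo-* : ∀ m n → ℤ→ℚ (m ℤ.* n) ≡ ℤ→ℚ m * ℤ→ℚ n
ℤ→ℚ-homo-* m n = ℚP.toℚᵘ-injective (begin
  ℚ.toℚᵘ (ℤ→ℚ (m ℤ.* n))                 ≈⟨ toℚᵘ-ℤ→ℚ (m ℤ.* n) ⟩
  ℚᵘ.mkℚᵘ m 0 ℚᵘ.* ℚᵘ.mkℚᵘ n 0           ≈⟨ ℚᵘP.*-cong (toℚᵘ-ℤ→ℚ m) (toℚᵘ-ℤ→ℚ n) ⟨
  ℚ.toℚᵘ (ℤ→ℚ m) ℚᵘ.* ℚ.toℚᵘ (ℤ→ℚ n)    ≈⟨ ℚP.toℚᵘ-homo-* (ℤ→ℚ m) (ℤ→ℚ n) ⟨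
  ℚ.toℚᵘ (ℤ→ℚ m * ℤ→ℚ n)                 ∎)
  where open ℚᵘP.≃-Reasoning

ℤ→ℚ-homo-+ : ∀ m n → ℤ→ℚ (m ℤ.+ n) ≡ ℤ→ℚ m + ℤ→ℚ n
ℤ→ℚ-homo-+ m n = ℚP.toℚᵘ-injective (begin
  ℚ.toℚᵘ (ℤ→ℚ (m ℤ.+ n))                 ≈⟨ toℚᵘ-ℤ→ℚ (m ℤ.+ n) ⟩
  ℚᵘ.mkℚᵘ (m ℤ.+ n) 0                    ≈⟨ ℚᵘ.*≡* (cong (ℤ._* ℤ.1ℤ) m+n≡m*1+n*1) ⟩
  ℚᵘ.mkℚᵘ m 0 ℚᵘ.+ ℚᵘ.mkℚᵘ n 0           ≈⟨ ℚᵘP.+-cong (toℚᵘ-ℤ→ℚ m) (toℚᵘ-ℤ→ℚ n) ⟨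
  ℚ.toℚᵘ (ℤ→ℚ m) ℚᵘ.+ ℚ.toℚᵘ (ℤ→ℚ n)    ≈⟨ ℚP.toℚᵘ-homo-+ (ℤ→ℚ m) (ℤ→ℚ n) ⟨
  ℚ.toℚᵘ (ℤ→ℚ m + ℤ→ℚ n)                 ∎)
  where
  open ℚᵘP.≃-Reasoning
  m+n≡m*1+n*1 : m ℤ.+ n ≡ m ℤ.* ℤ.1ℤ ℤ.+ n ℤ.* ℤ.1ℤ
  m+n≡m*1+n*1 = sym (cong₂ ℤ._+_ (ℤP.*-identityʳ m) (ℤP.*-identityʳ n))

ℤ→ℚ-homo-neg : ∀ n → ℤ→ℚ (- n) ≡ ℚ.- ℤ→ℚ n
ℤ→ℚ-homo-neg n = ℚP.toℚᵘ-injective (begin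
  ℚ.toℚᵘ (ℤ→ℚ (- n))     ≈⟨ toℚᵘ-ℤ→ℚ (- n) ⟩
  ℚᵘ.- ℚᵘ.mkℚᵘ n 0         ≈⟨ ℚᵘP.-‿cong (toℚᵘ-ℤ→ℚ n) ⟨
  ℚᵘ.- ℚ.toℚᵘ (ℤ→ℚ n)     ≈⟨ ℚP.toℚᵘ-homo‿- (ℤ→ℚ n) ⟨
  ℚ.toℚᵘ (ℚ.- ℤ→ℚ n)      ∎)
  where open ℚᵘP.≃-Reasoning

q*↧q≡↥q : ∀ q → q * ℤ→ℚ (↧ q) ≡ ℤ→ℚ (↥ q)
q*↧q≡↥q q@record{} = ℚP.toℚᵘ-injective (begin
  ℚ.toℚᵘ (q * ℤ→ℚ (↧ q))                 ≈⟨ ℚP.toℚᵘ-homo-* q (ℤ→ℚ (↧ q)) ⟩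
  ℚ.toℚᵘ q ℚᵘ.* ℚ.toℚᵘ (ℤ→ℚ (↧ q))      ≈⟨ ℚᵘP.*-congˡ {ℚ.toℚᵘ q} (toℚᵘ-ℤ→ℚ (↧ q)) ⟩
  ℚ.toℚᵘ q ℚᵘ.* ℚᵘ.mkℚᵘ (↧ q) 0         ≈⟨ ℚᵘ.*≡* (ℤP.*-assoc (↥ q) (↧ q) ℤ.1ℤ) ⟩
  ℚᵘ.mkℚᵘ (↥ q) 0                        ≈⟨ toℚᵘ-ℤ→ℚ (↥ q) ⟨
  ℚ.toℚᵘ (ℤ→ℚ (↥ q))                     ∎)
  where open ℚᵘP.≃-Reasoning

cross-multiply : ∀ q {m n} → q * ℤ→ℚ m ≡ ℤ→ℚ n → ↥ q ℤ.* m ≡ n ℤ.* ↧ q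
cross-multiply q@record{} {m} {n} eq with (begin
  ℚᵘ.mkℚᵘ n 0                       ≈⟨ toℚᵘ-ℤ→ℚ n ⟨
  ℚ.toℚᵘ (ℤ→ℚ n)                    ≡⟨ cong ℚ.toℚᵘ eq ⟨
  ℚ.toℚᵘ (q * ℤ→ℚ m)                ≈⟨ ℚP.toℚᵘ-homo-* q (ℤ→ℚ m) ⟩
  ℚ.toℚᵘ q ℚᵘ.* ℚ.toℚᵘ (ℤ→ℚ m)     ≈⟨ ℚᵘP.*-congˡ {ℚ.toℚᵘ q} (toℚᵘ-ℤ→ℚ m) ⟩
  ℚ.toℚᵘ q ℚᵘ.* ℚᵘ.mkℚᵘ m 0        ∎)
  where open ℚᵘP.≃-Reasoning
... | ℚᵘ.*≡* n*[↧q*1]≡↥q*m*1 =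
  trans (sym (ℤP.*-identityʳ _)) (trans (sym n*[↧q*1]≡↥q*m*1) (cong (n ℤ.*_) (ℤP.*-identityʳ (↧ q))))

fraction-+ : ∀ {q r m m′ n n′} → q * ℤ→ℚ m ≡ ℤ→ℚ n → r * ℤ→ℚ m′ ≡ ℤ→ℚ n′ →
  (q + r) * ℤ→ℚ (m ℤ.* m′) ≡ ℤ→ℚ (n ℤ.* m′ ℤ.+ n′ ℤ.* m)
fraction-+ {q} {r} {m} {m′} {n} {n′} eq eq′ = begin
  (q + r) * ℤ→ℚ (m ℤ.* m′)
    ≡⟨ cong ((q + r) *_) (ℤ→ℚ-homo-* m m′) ⟩
  (q + r) * (ℤ→ℚ m * ℤ→ℚ m′)
    ≡⟨ solve 4 (λ q r M M′ → (q :+ r) :* (M :* M′) := q :* M :* M′ :+ r :* M′ :* M) refl q r (ℤ→ℚ m) (ℤ→ℚ m′) ⟩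
  q * ℤ→ℚ m * ℤ→ℚ m′ + r * ℤ→ℚ m′ * ℤ→ℚ m
    ≡⟨ cong₂ (λ a b → a * ℤ→ℚ m′ + b * ℤ→ℚ m) eq eq′ ⟩
  ℤ→ℚ n * ℤ→ℚ m′ + ℤ→ℚ n′ * ℤ→ℚ m
    ≡⟨ cong₂ _+_ (ℤ→ℚ-homo-* n m′) (ℤ→ℚ-homo-* n′ m) ⟨
  ℤ→ℚ (n ℤ.* m′) + ℤ→ℚ (n′ ℤ.* m)
    ≡⟨ ℤ→ℚ-homo-+ (n ℤ.* m′) (n′ ℤ.* m) ⟨
  ℤ→ℚ (n ℤ.* m′ ℤ.+ n′ ℤ.* m)
    ∎
  where open ≡-Reasoning

fraction-* : ∀ {q r m m′ n n′} → q * ℤ→ℚ m ≡ ℤ→ℚ n → r * ℤ→ℚ m′ ≡ ℤ→ℚ n′ →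
  (q * r) * ℤ→ℚ (m ℤ.* m′) ≡ ℤ→ℚ (n ℤ.* n′)
fraction-* {q} {r} {m} {m′} {n} {n′} eq eq′ = begin
  (q * r) * ℤ→ℚ (m ℤ.* m′)        ≡⟨ cong ((q * r) *_) (ℤ→ℚ-homo-* m m′) ⟩
  (q * r) * (ℤ→ℚ m * ℤ→ℚ m′)      ≡⟨ solve 4 (λ q r M M′ → (q :* r) :* (M :* M′) := (q :* M) :* (r :* M′))
                                              refl q r (ℤ→ℚ m) (ℤ→ℚ m′) ⟩
  (q * ℤ→ℚ m) * (r * ℤ→ℚ m′)      ≡⟨ cong₂ _*_ eq eq′ ⟩
  ℤ→ℚ n * ℤ→ℚ n′                  ≡⟨ ℤ→ℚ-homo-* n n′ ⟨
  ℤ→ℚ (n ℤ.* n′)                  ∎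
  where open ≡-Reasoning

fraction-neg : ∀ {q m n} → q * ℤ→ℚ m ≡ ℤ→ℚ n → (ℚ.- q) * ℤ→ℚ m ≡ ℤ→ℚ (- n)
fraction-neg {q} {m} {n} eq =
  trans (sym (ℚP.neg-distribˡ-* q (ℤ→ℚ m))) (trans (cong ℚ.-_ eq) (sym (ℤ→ℚ-homo-neg n)))

reciprocal-root : ∀ {c c₃ c₂ c₁ c₀ x y} → x * y ≡ 1ℚ →
  c * (x * x * x * x) + c₃ * (x * x * x) + c₂ * (x * x) + c₁ * x + c₀ ≡ 0ℚ →
  c ≡ ℚ.- (c₃ * y + c₂ * (y * y) + c₁ * (y * y * y) + c₀ * (y * y * y * y))
reciprocal-root {c} {c₃} {c₂} {c₁} {c₀} {x} {y} xy≡1 root = begin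
  c                        ≡⟨ solve 6 (λ c c₃ c₂ c₁ c₀ y →
                                c := R′ c c₃ c₂ c₁ c₀ (con 1ℚ) y :+ :- H′ c₃ c₂ c₁ c₀ y) refl c c₃ c₂ c₁ c₀ y ⟩
  R 1ℚ - H                 ≡⟨ cong (λ z → R z - H) xy≡1 ⟨
  R (x * y) - H            ≡⟨ cong (_- H) (solve 7 (λ c c₃ c₂ c₁ c₀ x y →
                                R′ c c₃ c₂ c₁ c₀ (x :* y) y
                                  := y :* y :* y :* y :* (c :* (x :* x :* x :* x) :+ c₃ :* (x :* x :* x)
                                                          :+ c₂ :* (x :* x) :+ c₁ :* x :+ c₀))
                                refl c c₃ c₂ c₁ c₀ x y) ⟩
  y * y * y * y * P - H    ≡⟨ cong (λ v → y * y * y * y * v - H) root ⟩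
  y * y * y * y * 0ℚ - H   ≡⟨ cong (_- H) (ℚP.*-zeroʳ (y * y * y * y)) ⟩
  0ℚ - H                   ≡⟨ ℚP.+-identityˡ (ℚ.- H) ⟩
  ℚ.- H                    ∎
  where
  open ≡-Reasoning
  P H : ℚ
  P = c * (x * x * x * x) + c₃ * (x * x * x) + c₂ * (x * x) + c₁ * x + c₀
  H = c₃ * y + c₂ * (y * y) + c₁ * (y * y * y) + c₀ * (y * y * y * y)
  R : ℚ → ℚ
  R z = c * (z * z * z * z) + c₃ * (z * z * z) * y + c₂ * (z * z) * (y * y) + c₁ * z * (y * y * y)
          + c₀ * (y * y * y * y)
  R′ : ∀ {k} (c c₃ c₂ c₁ c₀ z y : Polynomial k) → Polynomial k
  R′ c c₃ c₂ c₁ c₀ z y = c :* (z :* z :* z :* z) :+ c₃ :* (z :* z :* z) :* y :+ c₂ :* (z :* z) :* (y :* y)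
                          :+ c₁ :* z :* (y :* y :* y) :+ c₀ :* (y :* y :* y :* y)
  H′ : ∀ {k} (c₃ c₂ c₁ c₀ y : Polynomial k) → Polynomial k
  H′ c₃ c₂ c₁ c₀ y = c₃ :* y :+ c₂ :* (y :* y) :+ c₁ :* (y :* y :* y) :+ c₀ :* (y :* y :* y :* y)

square-reciprocal : ∀ {F D w y} → F ≡ D * (w * w) → w * y ≡ 1ℚ → D ≡ F * (y * y)
square-reciprocal {F} {D} {w} {y} F≡Dw² wy≡1 = begin
  D                       ≡⟨ solve 1 (λ D → D := D :* (con 1ℚ :* con 1ℚ)) refl D ⟩
  D * (1ℚ * 1ℚ)           ≡⟨ cong (λ v → D * (v * v)) wy≡1 ⟨
  D * (w * y * (w * y))   ≡⟨ solve 3 (λ D w y → D :* (w :* y :* (w :* y)) := D :* (w :* w) :* (y :* y))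
                                     refl D w y ⟩
  D * (w * w) * (y * y)   ≡⟨ cong (_* (y * y)) F≡Dw² ⟨
  F * (y * y)             ∎
  where open ≡-Reasoning

p²∣m*n⇒p²∣m : ∀ {p m n} → Prime p → p ℕ.* p ∣ m ℕ.* n → ¬ p ∣ n → p ℕ.* p ∣ m
p²∣m*n⇒p²∣m {p} {m} {n} p-prime p²∣mn p∤n
  with euclidsLemma m n p-prime (ℕD.∣-trans (ℕD.m∣m*n p) p²∣mn)
... | inj₂ p∣n = contradiction p∣n p∤n
... | inj₁ (divides k refl) = ℕD.*-monoˡ-∣ p p∣k
  where
  instance
    p-nonZero : ℕ.NonZero p
    p-nonZero = prime⇒nonZero p-prime
  p∣k*n : p ∣ k ℕ.* n
  p∣k*n = ℕD.*-cancelˡ-∣ p (subst (p ℕ.* p ∣_)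
    (trans (cong (ℕ._* n) (ℕP.*-comm k p)) (ℕP.*-assoc p k n)) p²∣mn)
  p∣k : p ∣ k
  p∣k = Sum.[ (λ p∣k → p∣k) , (λ p∣n → contradiction p∣n p∤n) ]′ (euclidsLemma k n p-prime p∣k*n)

b₄-at²≡b₂-at*b₆-at-4b₈-at : ∀ a₁ a₂ a₃ a₄ a₆ x →
  b₄-at a₁ a₂ a₃ a₄ a₆ x * b₄-at a₁ a₂ a₃ a₄ a₆ x
    ≡ b₂-at a₁ a₂ a₃ a₄ a₆ x * b₆-at a₁ a₂ a₃ a₄ a₆ x - κ 4 * b₈-at a₁ a₂ a₃ a₄ a₆ x
b₄-at²≡b₂-at*b₆-at-4b₈-at = solve 6 (λ a₁ a₂ a₃ a₄ a₆ x →
  Poly.b₄-at a₁ a₂ a₃ a₄ a₆ x :* Poly.b₄-at a₁ a₂ a₃ a₄ a₆ x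
    := Poly.b₂-at a₁ a₂ a₃ a₄ a₆ x :* Poly.b₆-at a₁ a₂ a₃ a₄ a₆ x
       :+ :- (con (κ 4) :* Poly.b₈-at a₁ a₂ a₃ a₄ a₆ x)) refl

disc≡Δᵇ-at : ∀ a₁ a₂ a₃ a₄ a₆ x →
  disc (mkW a₁ a₂ a₃ a₄ a₆)
    ≡ Δᵇ (b₂-at a₁ a₂ a₃ a₄ a₆ x) (b₄-at a₁ a₂ a₃ a₄ a₆ x)
         (b₆-at a₁ a₂ a₃ a₄ a₆ x) (b₈-at a₁ a₂ a₃ a₄ a₆ x)
disc≡Δᵇ-at = solve 6 (λ a₁ a₂ a₃ a₄ a₆ x →
  Poly.Δ a₁ a₂ a₃ a₄ a₆
    := Poly.Δᵇ (Poly.b₂-at a₁ a₂ a₃ a₄ a₆ x) (Poly.b₄-at a₁ a₂ a₃ a₄ a₆ x)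
               (Poly.b₆-at a₁ a₂ a₃ a₄ a₆ x) (Poly.b₈-at a₁ a₂ a₃ a₄ a₆ x)) refl

-- With the coefficients of IsoToShort: scaling by u multiplies b₂ᵢ by u²ⁱ, and the model
-- obtained from y² = x³ + Ax + B through (r, s, t) has the b-invariants of that curve at x + r.
scale-b₈-at : ∀ u a₁ a₂ a₃ a₄ a₆ x →
  (u * u * u * u) * (u * u * u * u) * b₈-at a₁ a₂ a₃ a₄ a₆ x
    ≡ b₈-at (u * a₁) (u * u * a₂) (u * u * u * a₃) (u * u * u * u * a₄) (u * u * u * u * u * u * a₆)
            (u * u * x)
scale-b₈-at = solve 7 (λ u a₁ a₂ a₃ a₄ a₆ x →
  (u :* u :* u :* u) :* (u :* u :* u :* u) :* Poly.b₈-at a₁ a₂ a₃ a₄ a₆ x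
    := Poly.b₈-at (u :* a₁) (u :* u :* a₂) (u :* u :* u :* a₃) (u :* u :* u :* u :* a₄)
                  (u :* u :* u :* u :* u :* u :* a₆) (u :* u :* x)) refl

scale-b₆-at : ∀ u a₁ a₂ a₃ a₄ a₆ x →
  (u * u * u) * (u * u * u) * b₆-at a₁ a₂ a₃ a₄ a₆ x
    ≡ b₆-at (u * a₁) (u * u * a₂) (u * u * u * a₃) (u * u * u * u * a₄) (u * u * u * u * u * u * a₆)
            (u * u * x)
scale-b₆-at = solve 7 (λ u a₁ a₂ a₃ a₄ a₆ x →
  (u :* u :* u) :* (u :* u :* u) :* Poly.b₆-at a₁ a₂ a₃ a₄ a₆ x
    := Poly.b₆-at (u :* a₁) (u :* u :* a₂) (u :* u :* u :* a₃) (u :* u :* u :* u :* a₄)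
                  (u :* u :* u :* u :* u :* u :* a₆) (u :* u :* x)) refl

translate-b₈-at : ∀ s r t A B x →
  b₈-at (κ 2 * s) (ℚ.- s * s + κ 3 * r) (κ 2 * t) (A + κ 3 * (r * r) - κ 2 * (s * t))
        (B + r * A + r * r * r - t * t) x
    ≡ b₈-at 0ℚ 0ℚ 0ℚ A B (x + r)
translate-b₈-at = solve 6 (λ s r t A B x →
  Poly.b₈-at (con (κ 2) :* s) ((:- s) :* s :+ con (κ 3) :* r) (con (κ 2) :* t)
             (A :+ con (κ 3) :* (r :* r) :+ :- (con (κ 2) :* (s :* t)))
             (B :+ r :* A :+ r :* r :* r :+ :- (t :* t)) x
    := Poly.b₈-at (con 0ℚ) (con 0ℚ) (con 0ℚ) A B (x :+ r)) refl

translate-b₆-at : ∀ s r t A B x →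
  b₆-at (κ 2 * s) (ℚ.- s * s + κ 3 * r) (κ 2 * t) (A + κ 3 * (r * r) - κ 2 * (s * t))
        (B + r * A + r * r * r - t * t) x
    ≡ b₆-at 0ℚ 0ℚ 0ℚ A B (x + r)
translate-b₆-at = solve 6 (λ s r t A B x →
  Poly.b₆-at (con (κ 2) :* s) ((:- s) :* s :+ con (κ 3) :* r) (con (κ 2) :* t)
             (A :+ con (κ 3) :* (r :* r) :+ :- (con (κ 2) :* (s :* t)))
             (B :+ r :* A :+ r :* r :* r :+ :- (t :* t)) x
    := Poly.b₆-at (con 0ℚ) (con 0ℚ) (con 0ℚ) A B (x :+ r)) refl

twist-b₈-at : ∀ D A B x →
  (D * D) * (D * D) * b₈-at 0ℚ 0ℚ 0ℚ A B x ≡ b₈-at 0ℚ 0ℚ 0ℚ (D * D * A) (D * D * D * B) (D * x)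
twist-b₈-at = solve 4 (λ D A B x →
  (D :* D) :* (D :* D) :* Poly.b₈-at (con 0ℚ) (con 0ℚ) (con 0ℚ) A B x
    := Poly.b₈-at (con 0ℚ) (con 0ℚ) (con 0ℚ) (D :* D :* A) (D :* D :* D :* B) (D :* x)) refl

twist-b₆-at : ∀ D A B x →
  D * D * D * b₆-at 0ℚ 0ℚ 0ℚ A B x ≡ b₆-at 0ℚ 0ℚ 0ℚ (D * D * A) (D * D * D * B) (D * x)
twist-b₆-at = solve 4 (λ D A B x →
  D :* D :* D :* Poly.b₆-at (con 0ℚ) (con 0ℚ) (con 0ℚ) A B x
    := Poly.b₆-at (con 0ℚ) (con 0ℚ) (con 0ℚ) (D :* D :* A) (D :* D :* D :* B) (D :* x)) refl

short-b₈-at : ∀ A B x →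
  b₈-at 0ℚ 0ℚ 0ℚ A B x ≡ κ 12 * x * (x * x * x + A * x + B) - (κ 3 * x * x + A) * (κ 3 * x * x + A)
short-b₈-at = solve 3 (λ A B x →
  Poly.b₈-at (con 0ℚ) (con 0ℚ) (con 0ℚ) A B x
    := con (κ 12) :* x :* (x :* x :* x :+ A :* x :+ B)
       :+ :- ((con (κ 3) :* x :* x :+ A) :* (con (κ 3) :* x :* x :+ A))) refl

short-b₆-at : ∀ A B x → b₆-at 0ℚ 0ℚ 0ℚ A B x ≡ κ 4 * (x * x * x + A * x + B)
short-b₆-at = solve 3 (λ A B x →
  Poly.b₆-at (con 0ℚ) (con 0ℚ) (con 0ℚ) A B x := con (κ 4) :* (x :* x :* x :+ A :* x :+ B)) refl

tangent-identity : ∀ X Y l →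
  κ 12 * X * (Y * Y) - (l * (Y + Y)) * (l * (Y + Y)) ≡ κ 4 * (Y * Y) * (X - (l * l - X - X))
tangent-identity = solve 3 (λ X Y l →
  con (κ 12) :* X :* (Y :* Y) :+ :- ((l :* (Y :+ Y)) :* (l :* (Y :+ Y)))
    := con (κ 4) :* (Y :* Y) :* (X :+ :- (l :* l :+ :- X :+ :- X))) refl

short : ℚ → ℚ → Weierstrass
short A B = mkW 0ℚ 0ℚ 0ℚ A B

-- x is the x-coordinate of a 3-torsion point of W defined over ℚ(√D).
Is3TorsionAbscissa : Weierstrass → ℚ → ℚ → Set
Is3TorsionAbscissa (mkW a₁ a₂ a₃ a₄ a₆) D x =
  Σ ℚ λ w → b₈-at a₁ a₂ a₃ a₄ a₆ x ≡ 0ℚ × b₆-at a₁ a₂ a₃ a₄ a₆ x ≡ D * (w * w)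

tangent-root : ∀ {A B X Y l} → Y * Y ≡ X * X * X + A * X + B → l * (Y + Y) ≡ κ 3 * X * X + A →
  X - (l * l - X - X) ≡ 0ℚ → b₈-at 0ℚ 0ℚ 0ℚ A B X ≡ 0ℚ
tangent-root {A} {B} {X} {Y} {l} on-curve slope x[2P]≡X = begin
  b₈-at 0ℚ 0ℚ 0ℚ A B X
    ≡⟨ short-b₈-at A B X ⟩
  κ 12 * X * (X * X * X + A * X + B) - (κ 3 * X * X + A) * (κ 3 * X * X + A)
    ≡⟨ cong₂ (λ f m → κ 12 * X * f - m * m) on-curve slope ⟨
  κ 12 * X * (Y * Y) - (l * (Y + Y)) * (l * (Y + Y))
    ≡⟨ tangent-identity X Y l ⟩
  κ 4 * (Y * Y) * (X - (l * l - X - X))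
    ≡⟨ cong (κ 4 * (Y * Y) *_) x[2P]≡X ⟩
  κ 4 * (Y * Y) * 0ℚ
    ≡⟨ ℚP.*-zeroʳ (κ 4 * (Y * Y)) ⟩
  0ℚ ∎
  where open ≡-Reasoning

tangent-slope : ∀ A X Y → Y + Y ≢ 0ℚ → ℚ
tangent-slope A X Y 2Y≢0 = ℚ._÷_ (κ 3 * X * X + A) (Y + Y) {{ℚ.≢-nonZero 2Y≢0}}

-- The case analysis follows addPt: P + P is computed by the tangent (Y + Y ≢ 0, or else
-- 2P = O and 3P = P), and 2P + P = O forces the chord test x(2P) = X to succeed.
order-3⇒b₈-at≡0 : ∀ A B X Y → Y * Y ≡ X * X * X + A * X + B →
  addPt A B (addPt A B (just (X , Y)) (just (X , Y))) (just (X , Y)) ≡ nothing →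
  b₈-at 0ℚ 0ℚ 0ℚ A B X ≡ 0ℚ
order-3⇒b₈-at≡0 A B X Y on-curve 3P≡O with X - X ≟ 0ℚ
... | no X-X≢0 = contradiction (ℚP.+-inverseʳ X) X-X≢0
... | yes _ with Y + Y ≟ 0ℚ
...   | yes _ = case 3P≡O
  where case : just (X , Y) ≡ nothing → b₈-at 0ℚ 0ℚ 0ℚ A B X ≡ 0ℚ
        case ()
...   | no 2Y≢0
  with X - (tangent-slope A X Y 2Y≢0 * tangent-slope A X Y 2Y≢0 - X - X) ≟ 0ℚ
...     | yes x[2P]≡X = tangent-root {A} {B} {X} {Y} {tangent-slope A X Y 2Y≢0}
                            on-curve (÷-*-cancel (κ 3 * X * X + A) 2Y≢0) x[2P]≡X
...     | no _ = case 3P≡O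
  where case : ∀ {P} → just P ≡ nothing → b₈-at 0ℚ 0ℚ 0ℚ A B X ≡ 0ℚ
        case ()

untwist : ∀ A B D X Y → D ≢ 0ℚ → Y * Y ≡ X * X * X + D * D * A * X + D * D * D * B →
  b₈-at 0ℚ 0ℚ 0ℚ (D * D * A) (D * D * D * B) X ≡ 0ℚ → Σ ℚ (Is3TorsionAbscissa (short A B) D)
untwist A B D X Y D≢0 on-curve root =
  let x , Dx≡X = quotient D≢0 X
      w , b₆≡Dw² = square-quotient {D = D} {Z = κ 2 * Y} D²≢0 (D⁴b₆≡D[2Y]² x Dx≡X)
  in x , w , *-≡0-cancelˡ (*-≢0 D²≢0 D²≢0) (D⁴b₈≡0 x Dx≡X) , b₆≡Dw²
  where
  open ≡-Reasoning
  D²≢0 : D * D ≢ 0ℚ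
  D²≢0 = *-≢0 D≢0 D≢0
  D⁴b₈≡0 : ∀ x → D * x ≡ X → D * D * (D * D) * b₈-at 0ℚ 0ℚ 0ℚ A B x ≡ 0ℚ
  D⁴b₈≡0 x Dx≡X =
    trans (twist-b₈-at D A B x) (trans (cong (b₈-at 0ℚ 0ℚ 0ℚ (D * D * A) (D * D * D * B)) Dx≡X) root)
  D⁴b₆≡D[2Y]² : ∀ x → D * x ≡ X → D * D * (D * D) * b₆-at 0ℚ 0ℚ 0ℚ A B x ≡ D * (κ 2 * Y * (κ 2 * Y))
  D⁴b₆≡D[2Y]² x Dx≡X = begin
    D * D * (D * D) * b₆-at 0ℚ 0ℚ 0ℚ A B x
      ≡⟨ solve 2 (λ D b → D :* D :* (D :* D) :* b := D :* (D :* D :* D :* b))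
                 refl D (b₆-at 0ℚ 0ℚ 0ℚ A B x) ⟩
    D * (D * D * D * b₆-at 0ℚ 0ℚ 0ℚ A B x)
      ≡⟨ cong (D *_) (trans (twist-b₆-at D A B x)
                            (cong (b₆-at 0ℚ 0ℚ 0ℚ (D * D * A) (D * D * D * B)) Dx≡X)) ⟩
    D * b₆-at 0ℚ 0ℚ 0ℚ (D * D * A) (D * D * D * B) X
      ≡⟨ cong (D *_) (short-b₆-at (D * D * A) (D * D * D * B) X) ⟩
    D * (κ 4 * (X * X * X + D * D * A * X + D * D * D * B))
      ≡⟨ cong (λ f → D * (κ 4 * f)) on-curve ⟨
    D * (κ 4 * (Y * Y))
      ≡⟨ cong (D *_) (solve 1 (λ Y → con (κ 4) :* (Y :* Y) := con (κ 2) :* Y :* (con (κ 2) :* Y))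
                              refl Y) ⟩
    D * (κ 2 * Y * (κ 2 * Y)) ∎

change-of-model : ∀ {A B W D x} → IsoToShort A B W → Is3TorsionAbscissa (short A B) D x →
  Σ ℚ (Is3TorsionAbscissa W D)
change-of-model {A} {B} {mkW a₁ a₂ a₃ a₄ a₆} {D} {x}
  (u , r , s , t , u≢0 , e₁ , e₂ , e₃ , e₄ , e₆) (w , root , b₆≡Dw²) =
  let x′ , u²x′≡x-r = quotient (*-≢0 u≢0 u≢0) (x - r)
      u²x′+r≡x = trans (cong (_+ r) u²x′≡x-r) (solve 2 (λ x r → x :+ :- r :+ r := x) refl x r)
      w′ , b₆′≡Dw′² = square-quotient {D = D} {Z = w} u³≢0
        (trans (b₆-at-model x′) (trans (cong (b₆-at 0ℚ 0ℚ 0ℚ A B) u²x′+r≡x) b₆≡Dw²))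
      b₈′≡0 = *-≡0-cancelˡ (*-≢0 u⁴≢0 u⁴≢0)
        (trans (b₈-at-model x′) (trans (cong (b₈-at 0ℚ 0ℚ 0ℚ A B) u²x′+r≡x) root))
  in x′ , w′ , b₈′≡0 , b₆′≡Dw′²
  where
  u³≢0 : u * u * u ≢ 0ℚ
  u³≢0 = *-≢0 (*-≢0 u≢0 u≢0) u≢0
  u⁴≢0 : u * u * u * u ≢ 0ℚ
  u⁴≢0 = *-≢0 u³≢0 u≢0
  b₈-at-model : ∀ y →
    (u * u * u * u) * (u * u * u * u) * b₈-at a₁ a₂ a₃ a₄ a₆ y ≡ b₈-at 0ℚ 0ℚ 0ℚ A B (u * u * y + r)
  b₈-at-model y = trans (scale-b₈-at u a₁ a₂ a₃ a₄ a₆ y)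
    (trans (congₙ 5 (λ c₁ c₂ c₃ c₄ c₆ → b₈-at c₁ c₂ c₃ c₄ c₆ (u * u * y)) e₁ e₂ e₃ e₄ e₆)
           (translate-b₈-at s r t A B (u * u * y)))
  b₆-at-model : ∀ y →
    (u * u * u) * (u * u * u) * b₆-at a₁ a₂ a₃ a₄ a₆ y ≡ b₆-at 0ℚ 0ℚ 0ℚ A B (u * u * y + r)
  b₆-at-model y = trans (scale-b₆-at u a₁ a₂ a₃ a₄ a₆ y)
    (trans (congₙ 5 (λ c₁ c₂ c₃ c₄ c₆ → b₆-at c₁ c₂ c₃ c₄ c₆ (u * u * y)) e₁ e₂ e₃ e₄ e₆)
           (translate-b₆-at s r t A B (u * u * y)))

-- The local ring ℤ₍ₚ₎

module Localisation (p : ℕ) (p-prime : Prime p) where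

  open ℤD using (∣ᵤ⇒∣; ∣⇒∣ᵤ) renaming (_∣_ to _∣ℤ_)

  euclid : ∀ {m n} → + p ∣ℤ m ℤ.* n → + p ∣ℤ m ⊎ + p ∣ℤ n
  euclid {m} {n} p∣mn =
    Sum.map ∣ᵤ⇒∣ ∣ᵤ⇒∣ (euclidsLemma ℤ.∣ m ∣ ℤ.∣ n ∣ p-prime
      (subst (p ∣_) (ℤP.abs-* m n) (∣⇒∣ᵤ p∣mn)))

  ∤-* : ∀ {m n} → ¬ + p ∣ℤ m → ¬ + p ∣ℤ n → ¬ + p ∣ℤ m ℤ.* n
  ∤-* {m} {n} p∤m p∤n p∣mn = Sum.[ p∤m , p∤n ]′ (euclid {m} {n} p∣mn)

  ∣-*-cancelʳ : ∀ {m n} → + p ∣ℤ m ℤ.* n → ¬ + p ∣ℤ n → + p ∣ℤ m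
  ∣-*-cancelʳ {m} {n} p∣mn p∤n =
    Sum.[ (λ p∣m → p∣m) , (λ p∣n → contradiction p∣n p∤n) ]′ (euclid {m} {n} p∣mn)

  ∤1 : ¬ + p ∣ℤ + 1
  ∤1 p∣1 = ¬prime[1] (subst Prime (ℕD.∣1⇒≡1 (∣⇒∣ᵤ p∣1)) p-prime)

  ∣↥⇒∤↧ : ∀ q → + p ∣ℤ ↥ q → ¬ + p ∣ℤ ↧ q
  ∣↥⇒∤↧ (ℚ.mkℚ _ _ coprime) p∣↥q p∣↧q =
    ¬prime[1] (subst Prime (Coprimality.recompute coprime (∣⇒∣ᵤ p∣↥q , ∣⇒∣ᵤ p∣↧q)) p-prime)

  -- q ∈ ℤ₍ₚ₎, witnessed by any fraction with denominator prime to p (not necessarily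
  -- the reduced one, so that sums and products have evident witnesses).
  record Integral (q : ℚ) : Set where
    constructor fraction
    field
      numerator denominator : ℤ
      p∤denominator : ¬ + p ∣ℤ denominator
      q*denominator≡numerator : q * ℤ→ℚ denominator ≡ ℤ→ℚ numerator
  open Integral

  Divisible : ℚ → Set
  Divisible q = Σ (Integral q) λ i → + p ∣ℤ numerator i

  integral-+ : ∀ {q r} → Integral q → Integral r → Integral (q + r)
  integral-+ {q} {r} (fraction n m p∤m eq) (fraction n′ m′ p∤m′ eq′) =
    fraction (n ℤ.* m′ ℤ.+ n′ ℤ.* m) (m ℤ.* m′) (∤-* p∤m p∤m′)
      (fraction-+ {q} {r} {m} {m′} {n} {n′} eq eq′)

  integral-* : ∀ {q r} → Integral q → Integral r → Integral (q * r)
  integral-* {q} {r} (fraction n m p∤m eq) (fraction n′ m′ p∤m′ eq′) =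
    fraction (n ℤ.* n′) (m ℤ.* m′) (∤-* p∤m p∤m′)
      (fraction-* {q} {r} {m} {m′} {n} {n′} eq eq′)

  integral-neg : ∀ {q} → Integral q → Integral (ℚ.- q)
  integral-neg {q} (fraction n m p∤m eq) = fraction (- n) m p∤m (fraction-neg {q} {m} {n} eq)

  integral-ℤ : ∀ z → Integral (ℤ→ℚ z)
  integral-ℤ z = fraction z (+ 1) ∤1 (ℚP.*-identityʳ (ℤ→ℚ z))

  integral-κ : ∀ k → Integral (κ k)
  integral-κ k = integral-ℤ (+ k)

  integral-reduced : ∀ {q} → ¬ + p ∣ℤ ↧ q → Integral q
  integral-reduced {q} p∤↧q = fraction (↥ q) (↧ q) p∤↧q (q*↧q≡↥q q)

  PIntegral⇒integral : ∀ {q} → PIntegral p q → Integral q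
  PIntegral⇒integral p∤↧q = integral-reduced (λ p∣↧q → p∤↧q (∣⇒∣ᵤ p∣↧q))

  divisible-+ : ∀ {q r} → Divisible q → Divisible r → Divisible (q + r)
  divisible-+ (i , p∣n) (j , p∣n′) =
    integral-+ i j ,
    ℤD.∣m∣n⇒∣m+n (ℤD.∣m⇒∣m*n (denominator j) p∣n) (ℤD.∣m⇒∣m*n (denominator i) p∣n′)

  divisible-neg : ∀ {q} → Divisible q → Divisible (ℚ.- q)
  divisible-neg (i , p∣n) = integral-neg i , ℤD.∣m⇒∣-m p∣n

  divisible-*ˡ : ∀ {q r} → Divisible q → Integral r → Divisible (q * r)
  divisible-*ˡ (i , p∣n) j = integral-* i j , ℤD.∣m⇒∣m*n (numerator j) p∣n

  divisible-*ʳ : ∀ {q r} → Integral q → Divisible r → Divisible (q * r)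
  divisible-*ʳ i (j , p∣n′) = integral-* i j , ℤD.∣n⇒∣m*n (numerator i) p∣n′

  divisible-ℤ : ∀ {z} → + p ∣ℤ z → Divisible (ℤ→ℚ z)
  divisible-ℤ {z} p∣z = integral-ℤ z , p∣z

  divisible-ℤ⁻¹ : ∀ {z} → Divisible (ℤ→ℚ z) → + p ∣ℤ z
  divisible-ℤ⁻¹ {z} (fraction n m p∤m eq , p∣n) =
    ∣-*-cancelʳ (subst (+ p ∣ℤ_) (sym (ℤ→ℚ-injective (trans (ℤ→ℚ-homo-* z m) eq))) p∣n) p∤m

  divisible⇒∣↥ : ∀ {q} → Divisible q → + p ∣ℤ ↥ q
  divisible⇒∣↥ {q} (fraction n m p∤m eq , p∣n) =
    ∣-*-cancelʳ {↥ q} {m}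
      (subst (+ p ∣ℤ_) (sym (cross-multiply q {m} {n} eq)) (ℤD.∣m⇒∣m*n {m = n} (↧ q) p∣n)) p∤m

  reciprocal-divisible : ∀ {x} → + p ∣ℤ ↧ x → Σ ℚ λ y → Divisible y × x * y ≡ 1ℚ
  reciprocal-divisible {x} p∣↧x =
    1/ x , (fraction (↧ x) (↥ x) (λ p∣↥x → ∣↥⇒∤↧ x p∣↥x p∣↧x) 1/x*↥x≡↧x , p∣↧x) , ℚP.*-inverseʳ x
    where
    x≢0 : x ≢ 0ℚ
    x≢0 x≡0 = ∤1 (subst (λ v → + p ∣ℤ ↧ v) x≡0 p∣↧x)
    instance
      x-nonZero : ℚ.NonZero x
      x-nonZero = ℚ.≢-nonZero x≢0
    1/x*↥x≡↧x : 1/ x * ℤ→ℚ (↥ x) ≡ ℤ→ℚ (↧ x)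
    1/x*↥x≡↧x = begin
      1/ x * ℤ→ℚ (↥ x)         ≡⟨ cong (1/ x *_) (q*↧q≡↥q x) ⟨
      1/ x * (x * ℤ→ℚ (↧ x))   ≡⟨ ℚP.*-assoc (1/ x) x (ℤ→ℚ (↧ x)) ⟨
      1/ x * x * ℤ→ℚ (↧ x)     ≡⟨ cong (_* ℤ→ℚ (↧ x)) (ℚP.*-inverseˡ x) ⟩
      1ℚ * ℤ→ℚ (↧ x)           ≡⟨ ℚP.*-identityˡ (ℤ→ℚ (↧ x)) ⟩
      ℤ→ℚ (↧ x)                ∎
      where open ≡-Reasoning

  -- If p ∣ ↧ x then y = 1/x ∈ pℤ₍ₚ₎, and dividing the equation by x⁴ puts c in pℤ₍ₚ₎.
  integral-root : ∀ {c c₃ c₂ c₁ c₀ x} → ¬ + p ∣ℤ c →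
    Integral c₃ → Integral c₂ → Integral c₁ → Integral c₀ →
    ℤ→ℚ c * (x * x * x * x) + c₃ * (x * x * x) + c₂ * (x * x) + c₁ * x + c₀ ≡ 0ℚ → Integral x
  integral-root {c} {c₃} {c₂} {c₁} {c₀} {x} p∤c i₃ i₂ i₁ i₀ root with + p ℤD.∣? ↧ x
  ... | no p∤↧x = integral-reduced p∤↧x
  ... | yes p∣↧x =
    let y , y∣ , xy≡1 = reciprocal-divisible {x} p∣↧x
        iy = proj₁ y∣
        lower-terms = divisible-+ (divisible-+ (divisible-+
          (divisible-*ʳ i₃ y∣)
          (divisible-*ʳ i₂ (divisible-*ˡ y∣ iy)))
          (divisible-*ʳ i₁ (divisible-*ˡ (divisible-*ˡ y∣ iy) iy)))
          (divisible-*ʳ i₀ (divisible-*ˡ (divisible-*ˡ (divisible-*ˡ y∣ iy) iy) iy))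
        c≡-lower-terms = reciprocal-root {ℤ→ℚ c} {c₃} {c₂} {c₁} {c₀} {x} {y} xy≡1 root
    in contradiction (divisible-ℤ⁻¹ (subst Divisible (sym c≡-lower-terms) (divisible-neg lower-terms))) p∤c

  p²∣numerator⇒p²∣ : ∀ {z q} → ℤ→ℚ z ≡ q → (i : Integral q) →
    p ℕ.* p ∣ ℤ.∣ numerator i ∣ → p ℕ.* p ∣ ℤ.∣ z ∣
  p²∣numerator⇒p²∣ {z} refl (fraction n m p∤m eq) p²∣n =
    p²∣m*n⇒p²∣m p-prime (subst (p ℕ.* p ∣_) (trans (cong ℤ.∣_∣ (sym z*m≡n)) (ℤP.abs-* z m)) p²∣n)
      (λ p∣m → p∤m (∣ᵤ⇒∣ p∣m))
    where
    z*m≡n : z ℤ.* m ≡ n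
    z*m≡n = ℤ→ℚ-injective (trans (ℤ→ℚ-homo-* z m) eq)

  -- If w were not p-integral, d = F · (1/w)² would be divisible by p².
  divisible-d*square : ∀ {F d w} → Integral F → F ≡ ℤ→ℚ d * (w * w) →
    + p ∣ℤ d → ¬ p ℕ.* p ∣ ℤ.∣ d ∣ → Divisible F
  divisible-d*square {F} {d} {w} iF F≡dw² p∣d p²∤d with + p ℤD.∣? ↧ w
  ... | no p∤↧w = subst Divisible (sym F≡dw²) (divisible-*ˡ (divisible-ℤ p∣d) (integral-* iw iw))
    where
    iw : Integral w
    iw = integral-reduced {w} p∤↧w
  ... | yes p∣↧w =
    let y , (iy , p∣ny) , wy≡1 = reciprocal-divisible {w} p∣↧w
        nF = numerator iF
        ny = numerator iy
        p²∣nF*ny² = subst (p ℕ.* p ∣_)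
          (sym (trans (ℤP.abs-* nF (ny ℤ.* ny)) (cong (ℤ.∣ nF ∣ ℕ.*_) (ℤP.abs-* ny ny))))
          (ℕD.∣n⇒∣m*n ℤ.∣ nF ∣ (ℕD.*-pres-∣ (∣⇒∣ᵤ p∣ny) (∣⇒∣ᵤ p∣ny)))
        d≡F*y² = square-reciprocal {F} {ℤ→ℚ d} {w} {y} F≡dw² wy≡1
    in contradiction (p²∣numerator⇒p²∣ {d} d≡F*y² (integral-* iF (integral-* iy iy)) p²∣nF*ny²) p²∤d

  module _ {a₁ a₂ a₃ a₄ a₆ : ℚ}
    (i₁ : Integral a₁) (i₂ : Integral a₂) (i₃ : Integral a₃) (i₄ : Integral a₄) (i₆ : Integral a₆) where

    integral-b₂ : Integral (b₂ a₁ a₂ a₃ a₄ a₆)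
    integral-b₂ = integral-+ (integral-* i₁ i₁) (integral-* (integral-κ 4) i₂)

    integral-b₄ : Integral (b₄ a₁ a₂ a₃ a₄ a₆)
    integral-b₄ = integral-+ (integral-* (integral-κ 2) i₄) (integral-* i₁ i₃)

    integral-b₆ : Integral (b₆ a₁ a₂ a₃ a₄ a₆)
    integral-b₆ = integral-+ (integral-* i₃ i₃) (integral-* (integral-κ 4) i₆)

    integral-b₈ : Integral (b₈ a₁ a₂ a₃ a₄ a₆)
    integral-b₈ = integral-+ (integral-+ (integral-+ (integral-+
      (integral-* (integral-* i₁ i₁) i₆)
      (integral-* (integral-* (integral-κ 4) i₂) i₆))
      (integral-neg (integral-* (integral-* i₁ i₃) i₄)))
      (integral-* (integral-* i₂ i₃) i₃))
      (integral-neg (integral-* i₄ i₄))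

    module _ {x : ℚ} (ix : Integral x) where

      integral-b₂-at : Integral (b₂-at a₁ a₂ a₃ a₄ a₆ x)
      integral-b₂-at = integral-+ (integral-* (integral-κ 12) ix) integral-b₂

      integral-b₄-at : Integral (b₄-at a₁ a₂ a₃ a₄ a₆ x)
      integral-b₄-at = integral-+ (integral-+
        (integral-* (integral-κ 6) (integral-* ix ix))
        (integral-* integral-b₂ ix))
        integral-b₄

      integral-b₆-at : Integral (b₆-at a₁ a₂ a₃ a₄ a₆ x)
      integral-b₆-at = integral-+ (integral-+ (integral-+
        (integral-* (integral-κ 4) (integral-* (integral-* ix ix) ix))
        (integral-* integral-b₂ (integral-* ix ix)))
        (integral-* (integral-* (integral-κ 2) integral-b₄) ix))
        integral-b₆

  divisible-Δᵇ : ∀ {c₂ c₄ c₆ c₈} → Integral c₂ → Integral c₄ → c₄ * c₄ ≡ c₂ * c₆ - κ 4 * c₈ → c₈ ≡ 0ℚ →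
    Divisible c₆ → Divisible (Δᵇ c₂ c₄ c₆ c₈)
  divisible-Δᵇ {c₂} {c₄} {c₆} {c₈} i₂ i₄ c₄²≡c₂c₆-4c₈ c₈≡0 d₆ =
    divisible-+ (divisible-+ (divisible-+
      (divisible-neg (divisible-*ʳ (integral-* i₂ i₂) d₈))
      (divisible-neg (divisible-*ʳ (integral-κ 8) (divisible-*ˡ d₄² i₄))))
      (divisible-neg (divisible-*ʳ (integral-κ 27) (divisible-*ˡ d₆ (proj₁ d₆)))))
      (divisible-*ʳ (integral-κ 9) (divisible-*ʳ (integral-* i₂ i₄) d₆))
    where
    d₈ : Divisible c₈
    d₈ = subst Divisible (sym c₈≡0) (divisible-ℤ {+ 0} (∣ᵤ⇒∣ (p ℕD.∣0)))
    d₄² : Divisible (c₄ * c₄)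
    d₄² = subst Divisible (sym c₄²≡c₂c₆-4c₈)
      (divisible-+ (divisible-*ʳ i₂ d₆) (divisible-neg (divisible-*ʳ (integral-κ 4) d₈)))

  3-torsion⇒p∣disc : ∀ {W d x} → let open Weierstrass W in
    PIntegral p a₁ → PIntegral p a₂ → PIntegral p a₃ → PIntegral p a₄ → PIntegral p a₆ →
    ¬ p ∣ 3 → p ∣ ℤ.∣ d ∣ → ¬ p ℕ.* p ∣ ℤ.∣ d ∣ →
    Is3TorsionAbscissa W (ℤ→ℚ d) x → p ∣ ℤ.∣ ↥ disc W ∣
  3-torsion⇒p∣disc {mkW a₁ a₂ a₃ a₄ a₆} {d} {x} p₁ p₂ p₃ p₄ p₆ p∤3 p∣d p²∤d (w , root , b₆≡dw²) =
    ∣⇒∣ᵤ (divisible⇒∣↥ (subst Divisible (sym (disc≡Δᵇ-at a₁ a₂ a₃ a₄ a₆ x))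
      (divisible-Δᵇ (integral-b₂-at i₁ i₂ i₃ i₄ i₆ ix) (integral-b₄-at i₁ i₂ i₃ i₄ i₆ ix)
        (b₄-at²≡b₂-at*b₆-at-4b₈-at a₁ a₂ a₃ a₄ a₆ x) root
        (divisible-d*square {d = d} {w = w} (integral-b₆-at i₁ i₂ i₃ i₄ i₆ ix) b₆≡dw² (∣ᵤ⇒∣ p∣d) p²∤d))))
    where
    i₁ : Integral a₁
    i₁ = PIntegral⇒integral p₁
    i₂ : Integral a₂
    i₂ = PIntegral⇒integral p₂
    i₃ : Integral a₃
    i₃ = PIntegral⇒integral p₃
    i₄ : Integral a₄
    i₄ = PIntegral⇒integral p₄
    i₆ : Integral a₆
    i₆ = PIntegral⇒integral p₆
    ix : Integral x
    ix = integral-root {+ 3} (λ p∣3 → p∤3 (∣⇒∣ᵤ p∣3))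
      (integral-b₂ i₁ i₂ i₃ i₄ i₆) (integral-* (integral-κ 3) (integral-b₄ i₁ i₂ i₃ i₄ i₆))
      (integral-* (integral-κ 3) (integral-b₆ i₁ i₂ i₃ i₄ i₆)) (integral-b₈ i₁ i₂ i₃ i₄ i₆) root

  good-reduction⇒¬ramified-3-torsion : ∀ {E d x} → GoodReduction E p → ¬ p ∣ 3 → p ∣ ℤ.∣ d ∣ →
    ¬ p ℕ.* p ∣ ℤ.∣ d ∣ → ¬ Is3TorsionAbscissa (short (a E) (b E)) (ℤ→ℚ d) x
  good-reduction⇒¬ramified-3-torsion {E} {d} {x}
    (W , iso , p₁ , p₂ , p₃ , p₄ , p₆ , _ , p∤Δ) p∤3 p∣d p²∤d torsion =
    let x′ , torsion-on-W = change-of-model {a E} {b E} {W} {ℤ→ℚ d} {x} iso torsion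
    in p∤Δ (3-torsion⇒p∣disc {W} {d} {x′} p₁ p₂ p₃ p₄ p₆ p∤3 p∣d p²∤d torsion-on-W)

-- Ramified primes

prime-factor : ∀ {n} → n ≢ 0 → n ≢ 1 → Σ ℕ λ p → Prime p × p ∣ n
prime-factor {0} n≢0 _ = contradiction refl n≢0
prime-factor {n@(suc _)} _ n≢1 =
  first (PrimeFactorisation.factors f) (PrimeFactorisation.isFactorisation f)
    (PrimeFactorisation.factorsPrime f)
  where
  f : PrimeFactorisation n
  f = factorise n
  first : ∀ ps → n ≡ product ps → All Prime ps → Σ ℕ λ p → Prime p × p ∣ n
  first [] n≡1 _ = contradiction n≡1 n≢1
  first (p ∷ ps) n≡p*ps (p-prime ∷ _) = p , p-prime , subst (p ∣_) (sym n≡p*ps) (ℕD.m∣m*n (product ps))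

p∣3⇒p≡3 : ∀ {p} → Prime p → p ∣ 3 → p ≡ 3
p∣3⇒p≡3 p-prime p∣3 with prime⇒irreducible (toWitness {a? = prime? 3} _) p∣3
... | inj₁ p≡1 = contradiction (subst Prime p≡1 p-prime) ¬prime[1]
... | inj₂ p≡3 = p≡3

prime-factor-avoiding-3 : ∀ {n} → n ≢ 0 → n ≢ 1 → ¬ 3 ∣ n → Σ ℕ λ p → Prime p × p ∣ n × ¬ p ∣ 3
prime-factor-avoiding-3 {n} n≢0 n≢1 3∤n =
  let p , p-prime , p∣n = prime-factor n≢0 n≢1
  in p , p-prime , p∣n , λ p∣3 → 3∤n (subst (_∣ n) (p∣3⇒p≡3 p-prime p∣3) p∣n)

prime-factor-coprime-to-3 : ∀ {n} → n ≢ 0 → n ≢ 1 → n ≢ 3 → ¬ 3 ℕ.* 3 ∣ n →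
  Σ ℕ λ p → Prime p × p ∣ n × ¬ p ∣ 3
prime-factor-coprime-to-3 {n} n≢0 n≢1 n≢3 9∤n with 3 ∣? n
... | no 3∤n = prime-factor-avoiding-3 n≢0 n≢1 3∤n
... | yes (divides q refl) =
  let p , p-prime , p∣q , p∤3 =
        prime-factor-avoiding-3 (λ q≡0 → n≢0 (cong (ℕ._* 3) q≡0)) (λ q≡1 → n≢3 (cong (ℕ._* 3) q≡1)) 3∤q
  in p , p-prime , ℕD.∣-trans p∣q (ℕD.m∣m*n 3) , p∤3
  where
  3∤q : ¬ 3 ∣ q
  3∤q (divides k refl) = 9∤n (divides k (ℕP.*-assoc k 3 3))

squarefree⇒∣∣≢0 : ∀ {d} → SquareFree d → ℤ.∣ d ∣ ≢ 0
squarefree⇒∣∣≢0 sf |d|≡0 = contradiction (sf 0 (subst (0 ∣_) (sym |d|≡0) (ℕD.∣-refl {0}))) λ ()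

∣i∣≢suc : ∀ {i k} → i ≢ + suc k → i ≢ -[1+ k ] → ℤ.∣ i ∣ ≢ suc k
∣i∣≢suc {+ _} i≢k _ refl = i≢k refl
∣i∣≢suc { -[1+ _ ]} _ i≢-k refl = i≢-k refl

ramified-prime : ∀ {d} → d ≢ + 1 → d ≢ - + 1 → d ≢ + 3 → d ≢ - + 3 → SquareFree d →
  Σ ℕ λ p → Prime p × p ∣ ℤ.∣ d ∣ × ¬ p ∣ 3 × ¬ p ℕ.* p ∣ ℤ.∣ d ∣
ramified-prime {d} d≢1 d≢-1 d≢3 d≢-3 sf =
  let p , p-prime , p∣d , p∤3 = prime-factor-coprime-to-3 (squarefree⇒∣∣≢0 {d} sf)
        (∣i∣≢suc d≢1 d≢-1) (∣i∣≢suc d≢3 d≢-3) (λ 9∣d → contradiction (sf 3 9∣d) λ ())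
  in p , p-prime , p∣d , p∤3 , λ p²∣d → ¬prime[1] (subst Prime (sf p p²∣d) p-prime)

proposition2p5 : (E : EllipticCurve) (d : ℤ) → d ≢ + 1 → d ≢ - + 1 → d ≢ + 3 → d ≢ - + 3 → SquareFree d → CoprimeToConductor d E → ¬ TwistHasPointOfOrder3 E d
proposition2p5 E d d≢1 d≢-1 d≢3 d≢-3 sf coprime (nothing , _ , O≢O , _) = O≢O refl
proposition2p5 E d d≢1 d≢-1 d≢3 d≢-3 sf coprime (just (X , Y) , on-curve , _ , 3P≡O) =
  let p , p-prime , p∣d , p∤3 , p²∤d = ramified-prime d≢1 d≢-1 d≢3 d≢-3 sf
      root = order-3⇒b₈-at≡0 (twistA E d) (twistB E d) X Y on-curve 3P≡O
      x , torsion = untwist (a E) (b E) (ℤ→ℚ d) X Y D≢0 on-curve root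
  in Localisation.good-reduction⇒¬ramified-3-torsion p p-prime {E} {d} {x}
       (coprime p p-prime p∣d) p∤3 p∣d p²∤d torsion
  where
  D≢0 : ℤ→ℚ d ≢ 0ℚ
  D≢0 D≡0 = squarefree⇒∣∣≢0 {d} sf (cong ℤ.∣_∣ (ℤ→ℚ-injective {d} {+ 0} D≡0))
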